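{- Let $m \geq 1$ and $a \geq 1$ be integers, and let $R_m(q)$ be the $(m+1)\times(m+1)$ matrix over $\mathbb{Z}[q]$ with entries $R_m(q)_{ij} = q^{m+1-j}$ if $i \leq j$ and $R_m(q)_{ij} = 0$ if $i > j$ (indices $1 \le i,j \le m+1$). Then for all $1 \leq i \leq m+1$ and all $k \geq 0$ with $j = i+k \leq m+1$, \[ \left( R_m(q)^a \right)_{i,i+k} = q^{a(m+1-i-k)} \left(\!\!\binom{a}{k}\!\!\right)_q = q^{a(m+1-j)} \binom{a+j-i-1}{j-i}_q. \]
   Context: Notation: $[n]_q = 1+q+\cdots+q^{n-1}$, $[n]_q! = [n]_q[n-1]_q\cdots[1]_q$, $\binom{n}{k}_q = \frac{[n]_q!}{[k]_q![n-k]_q!}$ (the Gaussian binomial coefficient), and the $q$-multichoose coefficient $\left(\!\!\binom{n}{k}\!\!\right)_q := \binom{n+k-1}{k}_q$. Equivalently $R_m(q) = R_m Q_m$ where $R_m$ is the upper triangular matrix with all entries on and above the diagonal equal to $1$ and $Q_m = \mathrm{diag}(q^m, q^{m-1}, \dots, q, 1)$. -}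

module Defs where

open import Data.Nat as ℕ using (ℕ; zero; suc; _∸_; _≤ᵇ_)
open import Data.Integer as ℤ using (ℤ; 0ℤ; 1ℤ)
open import Data.List using (List; []; _∷_; _++_; replicate)
open import Data.Fin using (Fin; toℕ)
open import Data.Bool using (if_then_else_)
open import Relation.Binary.PropositionalEquality using (_≡_)

-- Polynomials in ℤ[q]: coefficient lists, lowest degree first.
-- Two lists represent the same polynomial iff all coefficients agree
-- (trailing zeros are irrelevant).
Poly : Set
Poly = List ℤ

coeff : Poly → ℕ → ℤ
coeff []       _       = 0ℤ
coeff (c ∷ p)  zero    = c
coeff (c ∷ p)  (suc n) = coeff p n

infix 4 _≈_
_≈_ : Poly → Poly → Set
p ≈ r = ∀ n → coeff p n ≡ coeff r n

infixl 6 _⊕_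
_⊕_ : Poly → Poly → Poly
[]      ⊕ r       = r
(c ∷ p) ⊕ []      = c ∷ p
(c ∷ p) ⊕ (d ∷ r) = (c ℤ.+ d) ∷ (p ⊕ r)

scale : ℤ → Poly → Poly
scale c []      = []
scale c (d ∷ p) = (c ℤ.* d) ∷ scale c p

infixl 7 _⊛_
_⊛_ : Poly → Poly → Poly
[]      ⊛ r = []
(c ∷ p) ⊛ r = scale c r ⊕ (0ℤ ∷ (p ⊛ r))

𝟘 : Poly
𝟘 = []

𝟙 : Poly
𝟙 = 1ℤ ∷ []

qpow : ℕ → Poly
qpow n = replicate n 0ℤ ++ (1ℤ ∷ [])

qint : ℕ → Poly
qint zero    = 𝟘
qint (suc n) = qint n ⊕ qpow n

qfact : ℕ → Poly
qfact zero    = 𝟙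
qfact (suc n) = qint (suc n) ⊛ qfact n

Mat : ℕ → Set
Mat n = Fin n → Fin n → Poly

sumFin : ∀ {n} → (Fin n → Poly) → Poly
sumFin {zero}  f = 𝟘
sumFin {suc n} f = f Fin.zero ⊕ sumFin (λ i → f (Fin.suc i))

matMul : ∀ {n} → Mat n → Mat n → Mat n
matMul A B i j = sumFin (λ k → A i k ⊛ B k j)

idMat : ∀ {n} → Mat n
idMat i j = if toℕ i ℕ.≡ᵇ toℕ j then 𝟙 else 𝟘

matPow : ∀ {n} → Mat n → ℕ → Mat n
matPow A zero    = idMat
matPow A (suc a) = matMul A (matPow A a)

-- R_m(q): (m+1)×(m+1), 0-based indices i j : Fin (m+1);
-- entry q^{m-j} (= q^{m+1-j'} with 1-based j' = j+1) if i ≤ j, else 0.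
Rm : (m : ℕ) → Mat (suc m)
Rm m i j = if toℕ i ≤ᵇ toℕ j then qpow (m ∸ toℕ j) else 𝟘

-- By induction on a, the (x, y) entry of R_m(q)^a is q^{a(m-y)} ((a multichoose y-x))_q
-- for x ≤ y and 0 below the diagonal. Multiplying by R_m(q) sums column y of R_m(q)^a
-- over the rows l = x … y with weights q^{m-l}; after pulling out q^{(a+1)(m-y)} this is
-- the recurrence ((a+1 multichoose k)) = Σ_{t ≤ k} q^{k-t} ((a multichoose k-t)).
-- The factorial form follows from [k+l choose k]_q [k]_q! [l]_q! = [k+l]_q!, proved by q-Pascal.

{-# OPTIONS --safe #-}
module Submission where

open import Defs
open import Algebra.Bundles using (CommutativeMonoid; CommutativeSemiring; Monoid)
open import Algebra.Structures.Biased using (isCommutativeMonoidˡ; isCommutativeSemiringˡ)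
import Algebra.Properties.CommutativeSemigroup as CommutativeSemigroupProperties
import Algebra.Properties.Monoid.Sum as MonoidSum
import Algebra.Properties.Semiring.Sum as SemiringSum
open import Data.Bool using (true; false; if_then_else_)
open import Data.Empty using (⊥-elim)
open import Data.Fin using (Fin; toℕ)
open import Data.Fin.Properties using (toℕ≤pred[n])
open import Data.Integer as ℤ using (ℤ; 0ℤ; 1ℤ)
import Data.Integer.Properties as ℤ
open import Data.List using ([]; _∷_)
open import Data.Nat as ℕ using (ℕ; zero; suc; _+_; _*_; _∸_; _≤_; _<_; _≤ᵇ_; _≡ᵇ_; z≤n; s≤s; _≤?_)
import Data.Nat.Properties as ℕ
open import Data.Unit using (tt)
open import Data.Vec.Functional using (Vector)
open import Function using (_∘_)
open import Level using (0ℓ)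
open import Relation.Binary.Bundles using (Setoid)
open import Relation.Binary.PropositionalEquality
  using (_≡_; refl; sym; trans; cong; cong₂; module ≡-Reasoning)
import Relation.Binary.Reasoning.Setoid as SetoidReasoning
open import Relation.Nullary using (¬_; yes; no)

private variable
  c d : ℤ
  p p' r r' : Poly

module _ {a ℓ} (M : Monoid a ℓ) where
  open Monoid M using (Carrier; ε; ∙-congˡ; ∙-congʳ; identityˡ)
    renaming (_≈_ to _≈ₘ_; trans to ≈ₘ-trans)
  open MonoidSum M using (sum; sum-cong-≋; sum-replicate-zero)

  sum-zeros : ∀ {n} (f : Vector Carrier n) → (∀ i → f i ≈ₘ ε) → sum f ≈ₘ ε
  sum-zeros {n} f f≈ε = ≈ₘ-trans (sum-cong-≋ f≈ε) (sum-replicate-zero n)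

  sum-window : ∀ {n} x y (h : ℕ → Carrier) → x ≤ y → y < n →
               (∀ l → l < x → h l ≈ₘ ε) → (∀ l → y < l → h l ≈ₘ ε) →
               sum {n} (h ∘ toℕ) ≈ₘ sum {suc (y ∸ x)} (λ t → h (x + toℕ t))
  sum-window {suc n} (suc x) (suc y) h (s≤s x≤y) (s≤s y<n) below above = ≈ₘ-trans
    (≈ₘ-trans (∙-congʳ (below 0 (s≤s z≤n))) (identityˡ _))
    (sum-window x y (h ∘ suc) x≤y y<n (λ l l<x → below (suc l) (s≤s l<x)) (λ l y<l → above (suc l) (s≤s y<l)))
  sum-window {suc n} zero zero h _ _ _ above =
    ∙-congˡ (sum-zeros {n} (h ∘ suc ∘ toℕ) (λ i → above (suc (toℕ i)) (s≤s z≤n)))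
  sum-window {suc n} zero (suc y) h _ (s≤s y<n) _ above =
    ∙-congˡ (sum-window zero y (h ∘ suc) z≤n y<n (λ _ ()) (λ l y<l → above (suc l) (s≤s y<l)))

-- Wrapping _≈_ in a record lets Agda recover both polynomials from the type of a proof.
infix 4 _≋_
record _≋_ (p r : Poly) : Set where
  constructor coeffwise
  field coeff-≡ : p ≈ r
open _≋_

≋-setoid : Setoid 0ℓ 0ℓ
≋-setoid = record
  { Carrier       = Poly
  ; _≈_           = _≋_
  ; isEquivalence = record
    { refl  = coeffwise λ _ → refl
    ; sym   = λ e → coeffwise λ n → sym (coeff-≡ e n)
    ; trans = λ e f → coeffwise λ n → trans (coeff-≡ e n) (coeff-≡ f n)
    }
  }

open Setoid ≋-setoid using (isEquivalence)
  renaming (refl to ≋-refl; sym to ≋-sym; trans to ≋-trans; reflexive to ≡⇒≋)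
module ≋-Reasoning = SetoidReasoning ≋-setoid

coeff-⊕ : ∀ p r n → coeff (p ⊕ r) n ≡ coeff p n ℤ.+ coeff r n
coeff-⊕ []      r       n       = sym (ℤ.+-identityˡ _)
coeff-⊕ (c ∷ p) []      n       = sym (ℤ.+-identityʳ _)
coeff-⊕ (c ∷ p) (d ∷ r) zero    = refl
coeff-⊕ (c ∷ p) (d ∷ r) (suc n) = coeff-⊕ p r n

coeff-scale : ∀ c p n → coeff (scale c p) n ≡ c ℤ.* coeff p n
coeff-scale c []      n       = sym (ℤ.*-zeroʳ c)
coeff-scale c (d ∷ p) zero    = refl
coeff-scale c (d ∷ p) (suc n) = coeff-scale c p n

∷-cong : c ≡ d → p ≋ r → c ∷ p ≋ d ∷ r
∷-cong c≡d e = coeffwise λ { zero → c≡d ; (suc n) → coeff-≡ e n }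

0∷[]≋[] : 0ℤ ∷ [] ≋ []
0∷[]≋[] = coeffwise λ { zero → refl ; (suc n) → refl }

⊕-cong : p ≋ p' → r ≋ r' → p ⊕ r ≋ p' ⊕ r'
⊕-cong {p} {p'} {r} {r'} e f = coeffwise λ n →
  trans (coeff-⊕ p r n) (trans (cong₂ ℤ._+_ (coeff-≡ e n) (coeff-≡ f n)) (sym (coeff-⊕ p' r' n)))

⊕-comm : ∀ p r → p ⊕ r ≋ r ⊕ p
⊕-comm p r = coeffwise λ n →
  trans (coeff-⊕ p r n) (trans (ℤ.+-comm (coeff p n) _) (sym (coeff-⊕ r p n)))

⊕-assoc : ∀ p r s → (p ⊕ r) ⊕ s ≋ p ⊕ (r ⊕ s)
⊕-assoc p r s = coeffwise λ n → begin
  coeff ((p ⊕ r) ⊕ s) n                    ≡⟨ coeff-⊕ (p ⊕ r) s n ⟩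
  coeff (p ⊕ r) n ℤ.+ coeff s n            ≡⟨ cong (ℤ._+ coeff s n) (coeff-⊕ p r n) ⟩
  (coeff p n ℤ.+ coeff r n) ℤ.+ coeff s n  ≡⟨ ℤ.+-assoc (coeff p n) _ _ ⟩
  coeff p n ℤ.+ (coeff r n ℤ.+ coeff s n)  ≡⟨ cong₂ ℤ._+_ (refl {x = coeff p n}) (coeff-⊕ r s n) ⟨
  coeff p n ℤ.+ coeff (r ⊕ s) n            ≡⟨ coeff-⊕ p (r ⊕ s) n ⟨
  coeff (p ⊕ (r ⊕ s)) n                    ∎
  where open ≡-Reasoning

⊕-identityʳ : ∀ p → p ⊕ 𝟘 ≋ p
⊕-identityʳ []      = ≋-refl
⊕-identityʳ (c ∷ p) = ≋-refl

⊕-commutativeMonoid : CommutativeMonoid 0ℓ 0ℓ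
⊕-commutativeMonoid = record
  { Carrier             = Poly
  ; _≈_                 = _≋_
  ; _∙_                 = _⊕_
  ; ε                   = 𝟘
  ; isCommutativeMonoid = isCommutativeMonoidˡ record
    { isSemigroup = record
      { isMagma = record { isEquivalence = isEquivalence ; ∙-cong = ⊕-cong }
      ; assoc   = ⊕-assoc
      }
    ; identityˡ = λ _ → ≋-refl
    ; comm      = ⊕-comm
    }
  }

module ⊕ = CommutativeSemigroupProperties (CommutativeMonoid.commutativeSemigroup ⊕-commutativeMonoid)

scale-congʳ : ∀ c → p ≋ r → scale c p ≋ scale c r
scale-congʳ {p} {r} c e = coeffwise λ n →
  trans (coeff-scale c p n) (trans (cong (c ℤ.*_) (coeff-≡ e n)) (sym (coeff-scale c r n)))

scale-⊕ : ∀ c p r → scale c (p ⊕ r) ≋ scale c p ⊕ scale c r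
scale-⊕ c p r = coeffwise λ n → begin
  coeff (scale c (p ⊕ r)) n                            ≡⟨ coeff-scale c (p ⊕ r) n ⟩
  c ℤ.* coeff (p ⊕ r) n                                ≡⟨ cong (c ℤ.*_) (coeff-⊕ p r n) ⟩
  c ℤ.* (coeff p n ℤ.+ coeff r n)                      ≡⟨ ℤ.*-distribˡ-+ c (coeff p n) _ ⟩
  c ℤ.* coeff p n ℤ.+ c ℤ.* coeff r n                  ≡⟨ cong₂ ℤ._+_ (coeff-scale c p n) (coeff-scale c r n) ⟨
  coeff (scale c p) n ℤ.+ coeff (scale c r) n          ≡⟨ coeff-⊕ (scale c p) (scale c r) n ⟨
  coeff (scale c p ⊕ scale c r) n                      ∎
  where open ≡-Reasoning

scale-+ : ∀ c d p → scale (c ℤ.+ d) p ≋ scale c p ⊕ scale d p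
scale-+ c d p = coeffwise λ n → begin
  coeff (scale (c ℤ.+ d) p) n                  ≡⟨ coeff-scale (c ℤ.+ d) p n ⟩
  (c ℤ.+ d) ℤ.* coeff p n                      ≡⟨ ℤ.*-distribʳ-+ (coeff p n) c d ⟩
  c ℤ.* coeff p n ℤ.+ d ℤ.* coeff p n          ≡⟨ cong₂ ℤ._+_ (coeff-scale c p n) (coeff-scale d p n) ⟨
  coeff (scale c p) n ℤ.+ coeff (scale d p) n  ≡⟨ coeff-⊕ (scale c p) (scale d p) n ⟨
  coeff (scale c p ⊕ scale d p) n              ∎
  where open ≡-Reasoning

scale-scale : ∀ c d p → scale c (scale d p) ≋ scale (c ℤ.* d) p
scale-scale c d p = coeffwise λ n → begin
  coeff (scale c (scale d p)) n  ≡⟨ coeff-scale c (scale d p) n ⟩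
  c ℤ.* coeff (scale d p) n      ≡⟨ cong (c ℤ.*_) (coeff-scale d p n) ⟩
  c ℤ.* (d ℤ.* coeff p n)        ≡⟨ ℤ.*-assoc c d (coeff p n) ⟨
  c ℤ.* d ℤ.* coeff p n          ≡⟨ coeff-scale (c ℤ.* d) p n ⟨
  coeff (scale (c ℤ.* d) p) n    ∎
  where open ≡-Reasoning

scale-zero : ∀ p → scale 0ℤ p ≋ 𝟘
scale-zero p = coeffwise λ n → trans (coeff-scale 0ℤ p n) (ℤ.*-zeroˡ (coeff p n))

scale-one : ∀ p → scale 1ℤ p ≋ p
scale-one p = coeffwise λ n → trans (coeff-scale 1ℤ p n) (ℤ.*-identityˡ (coeff p n))

⊛-zeroʳ : ∀ p → p ⊛ 𝟘 ≋ 𝟘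
⊛-zeroʳ []      = ≋-refl
⊛-zeroʳ (c ∷ p) = ≋-trans (∷-cong refl (⊛-zeroʳ p)) 0∷[]≋[]

⊛-congʳ : ∀ p → r ≋ r' → p ⊛ r ≋ p ⊛ r'
⊛-congʳ []      e = ≋-refl
⊛-congʳ (c ∷ p) e = ⊕-cong (scale-congʳ c e) (∷-cong refl (⊛-congʳ p e))

⊛-distribʳ : ∀ r p p' → (p ⊕ p') ⊛ r ≋ p ⊛ r ⊕ p' ⊛ r
⊛-distribʳ r []      p'       = ≋-refl
⊛-distribʳ r (c ∷ p) []       = ≋-sym (⊕-identityʳ _)
⊛-distribʳ r (c ∷ p) (d ∷ p') = ≋-trans
  (⊕-cong (scale-+ c d r) (∷-cong refl (⊛-distribʳ r p p')))
  (⊕.interchange (scale c r) (scale d r) (0ℤ ∷ p ⊛ r) (0ℤ ∷ p' ⊛ r))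

0∷-⊛ : ∀ p r → (0ℤ ∷ p) ⊛ r ≋ 0ℤ ∷ p ⊛ r
0∷-⊛ p r = ⊕-cong (scale-zero r) ≋-refl

scale-⊛ : ∀ c p r → scale c p ⊛ r ≋ scale c (p ⊛ r)
scale-⊛ c []      r = ≋-refl
scale-⊛ c (d ∷ p) r = begin
  scale (c ℤ.* d) r ⊕ (0ℤ ∷ scale c p ⊛ r)          ≈⟨ ⊕-cong (≋-sym (scale-scale c d r)) (∷-cong refl (scale-⊛ c p r)) ⟩
  scale c (scale d r) ⊕ (0ℤ ∷ scale c (p ⊛ r))      ≈⟨ ⊕-cong ≋-refl (∷-cong (ℤ.*-zeroʳ c) ≋-refl) ⟨
  scale c (scale d r) ⊕ scale c (0ℤ ∷ p ⊛ r)        ≈⟨ scale-⊕ c (scale d r) (0ℤ ∷ p ⊛ r) ⟨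
  scale c (scale d r ⊕ (0ℤ ∷ p ⊛ r))                ∎
  where open ≋-Reasoning

⊛-assoc : ∀ p r s → (p ⊛ r) ⊛ s ≋ p ⊛ (r ⊛ s)
⊛-assoc []      r s = ≋-refl
⊛-assoc (c ∷ p) r s = begin
  (scale c r ⊕ (0ℤ ∷ p ⊛ r)) ⊛ s           ≈⟨ ⊛-distribʳ s (scale c r) (0ℤ ∷ p ⊛ r) ⟩
  scale c r ⊛ s ⊕ (0ℤ ∷ p ⊛ r) ⊛ s        ≈⟨ ⊕-cong (scale-⊛ c r s) (0∷-⊛ (p ⊛ r) s) ⟩
  scale c (r ⊛ s) ⊕ (0ℤ ∷ (p ⊛ r) ⊛ s)    ≈⟨ ⊕-cong ≋-refl (∷-cong refl (⊛-assoc p r s)) ⟩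
  scale c (r ⊛ s) ⊕ (0ℤ ∷ p ⊛ (r ⊛ s))    ∎
  where open ≋-Reasoning

⊛-identityˡ : ∀ p → 𝟙 ⊛ p ≋ p
⊛-identityˡ p = ≋-trans (⊕-cong (scale-one p) 0∷[]≋[]) (⊕-identityʳ p)

⊛-∷ : ∀ p d r → p ⊛ (d ∷ r) ≋ scale d p ⊕ (0ℤ ∷ p ⊛ r)
⊛-∷ []      d r = ≋-sym 0∷[]≋[]
⊛-∷ (c ∷ p) d r = ∷-cong (cong (ℤ._+ 0ℤ) (ℤ.*-comm c d)) (begin
  scale c r ⊕ p ⊛ (d ∷ r)                     ≈⟨ ⊕-cong ≋-refl (⊛-∷ p d r) ⟩
  scale c r ⊕ (scale d p ⊕ (0ℤ ∷ p ⊛ r))      ≈⟨ ⊕.x∙yz≈y∙xz (scale c r) (scale d p) _ ⟩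
  scale d p ⊕ (scale c r ⊕ (0ℤ ∷ p ⊛ r))      ∎)
  where open ≋-Reasoning

⊛-comm : ∀ p r → p ⊛ r ≋ r ⊛ p
⊛-comm []      r = ≋-sym (⊛-zeroʳ r)
⊛-comm (c ∷ p) r = ≋-trans (⊕-cong ≋-refl (∷-cong refl (⊛-comm p r))) (≋-sym (⊛-∷ r c p))

⊛-cong : p ≋ p' → r ≋ r' → p ⊛ r ≋ p' ⊛ r'
⊛-cong {p} {p'} {r} {r'} e f = begin
  p ⊛ r    ≈⟨ ⊛-congʳ p f ⟩
  p ⊛ r'   ≈⟨ ⊛-comm p r' ⟩
  r' ⊛ p   ≈⟨ ⊛-congʳ r' e ⟩
  r' ⊛ p'  ≈⟨ ⊛-comm r' p' ⟩
  p' ⊛ r'  ∎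
  where open ≋-Reasoning

ℤ[q] : CommutativeSemiring 0ℓ 0ℓ
ℤ[q] = record
  { Carrier               = Poly
  ; _≈_                   = _≋_
  ; _+_                   = _⊕_
  ; _*_                   = _⊛_
  ; 0#                    = 𝟘
  ; 1#                    = 𝟙
  ; isCommutativeSemiring = isCommutativeSemiringˡ record
    { +-isCommutativeMonoid = CommutativeMonoid.isCommutativeMonoid ⊕-commutativeMonoid
    ; *-isCommutativeMonoid = isCommutativeMonoidˡ record
      { isSemigroup = record
        { isMagma = record { isEquivalence = isEquivalence ; ∙-cong = ⊛-cong }
        ; assoc   = ⊛-assoc
        }
      ; identityˡ = ⊛-identityˡ
      ; comm      = ⊛-comm
      }
    ; distribʳ = ⊛-distribʳ
    ; zeroˡ    = λ _ → ≋-refl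
    }
  }

open CommutativeSemiring ℤ[q] using (semiring; *-commutativeSemigroup; *-identityʳ; distribˡ; +-monoid)
module ⊛ = CommutativeSemigroupProperties *-commutativeSemigroup
open SemiringSum semiring using (sum; sum⁺-syntax; sum-cong-≋; *-distribˡ-sum)

qpow-+ : ∀ a b → qpow (a + b) ≋ qpow a ⊛ qpow b
qpow-+ zero    b = ≋-sym (⊛-identityˡ (qpow b))
qpow-+ (suc a) b = ≋-trans (∷-cong refl (qpow-+ a b)) (≋-sym (0∷-⊛ (qpow a) (qpow b)))

qint-+ : ∀ a b → qint (a + b) ≋ qint a ⊕ qpow a ⊛ qint b
qint-+ a zero    = begin
  qint (a + 0)             ≡⟨ cong qint (ℕ.+-identityʳ a) ⟩
  qint a                   ≈⟨ ⊕-identityʳ (qint a) ⟨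
  qint a ⊕ 𝟘               ≈⟨ ⊕-cong ≋-refl (⊛-zeroʳ (qpow a)) ⟨
  qint a ⊕ qpow a ⊛ 𝟘      ∎
  where open ≋-Reasoning
qint-+ a (suc b) = begin
  qint (a + suc b)                               ≡⟨ cong qint (ℕ.+-suc a b) ⟩
  qint (a + b) ⊕ qpow (a + b)                    ≈⟨ ⊕-cong (qint-+ a b) (qpow-+ a b) ⟩
  (qint a ⊕ qpow a ⊛ qint b) ⊕ qpow a ⊛ qpow b   ≈⟨ ⊕-assoc (qint a) _ _ ⟩
  qint a ⊕ (qpow a ⊛ qint b ⊕ qpow a ⊛ qpow b)   ≈⟨ ⊕-cong ≋-refl (distribˡ (qpow a) (qint b) (qpow b)) ⟨
  qint a ⊕ qpow a ⊛ (qint b ⊕ qpow b)            ∎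
  where open ≋-Reasoning

-- qbinom k l is the Gaussian binomial [k + l choose k]_q, defined by the q-Pascal rule.
qbinom : ℕ → ℕ → Poly
qbinom zero    l       = 𝟙
qbinom (suc k) zero    = 𝟙
qbinom (suc k) (suc l) = qbinom k (suc l) ⊕ qpow (suc k) ⊛ qbinom (suc k) l

qbinom-zeroʳ : ∀ k → qbinom k 0 ≡ 𝟙
qbinom-zeroʳ zero    = refl
qbinom-zeroʳ (suc k) = refl

qbinom-qfact : ∀ k l → qbinom k l ⊛ (qfact k ⊛ qfact l) ≋ qfact (k + l)
qbinom-qfact zero    l       = ≋-trans (⊛-identityˡ _) (⊛-identityˡ _)
qbinom-qfact (suc k) zero    = begin
  𝟙 ⊛ (qfact (suc k) ⊛ 𝟙)  ≈⟨ ⊛-identityˡ _ ⟩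
  qfact (suc k) ⊛ 𝟙        ≈⟨ *-identityʳ (qfact (suc k)) ⟩
  qfact (suc k)            ≡⟨ cong qfact (ℕ.+-identityʳ (suc k)) ⟨
  qfact (suc k + 0)        ∎
  where open ≋-Reasoning
qbinom-qfact (suc k) (suc l) = begin
  (X ⊕ Q ⊛ Y) ⊛ (qfact (suc k) ⊛ qfact (suc l))
    ≈⟨ ⊛-distribʳ _ X (Q ⊛ Y) ⟩
  X ⊛ ((K ⊛ qfact k) ⊛ qfact (suc l)) ⊕ (Q ⊛ Y) ⊛ (qfact (suc k) ⊛ (L ⊛ qfact l))
    ≈⟨ ⊕-cong (⊛-congʳ X (⊛-assoc K _ _)) (⊛-congʳ (Q ⊛ Y) (⊛.x∙yz≈y∙xz (qfact (suc k)) L (qfact l))) ⟩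
  X ⊛ (K ⊛ (qfact k ⊛ qfact (suc l))) ⊕ (Q ⊛ Y) ⊛ (L ⊛ (qfact (suc k) ⊛ qfact l))
    ≈⟨ ⊕-cong (⊛.x∙yz≈y∙xz X K _) (⊛.interchange Q Y L _) ⟩
  K ⊛ (X ⊛ (qfact k ⊛ qfact (suc l))) ⊕ (Q ⊛ L) ⊛ (Y ⊛ (qfact (suc k) ⊛ qfact l))
    ≈⟨ ⊕-cong (⊛-congʳ K (qbinom-qfact k (suc l))) (⊛-congʳ (Q ⊛ L) (qbinom-qfact (suc k) l)) ⟩
  K ⊛ qfact (k + suc l) ⊕ (Q ⊛ L) ⊛ qfact (suc k + l)
    ≡⟨ cong (λ n → K ⊛ qfact (k + suc l) ⊕ (Q ⊛ L) ⊛ qfact n) (ℕ.+-suc k l) ⟨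
  K ⊛ qfact (k + suc l) ⊕ (Q ⊛ L) ⊛ qfact (k + suc l)
    ≈⟨ ⊛-distribʳ _ K (Q ⊛ L) ⟨
  (K ⊕ Q ⊛ L) ⊛ qfact (k + suc l)
    ≈⟨ ⊛-cong (qint-+ (suc k) (suc l)) ≋-refl ⟨
  qfact (suc k + suc l)
    ∎
  where
  open ≋-Reasoning
  X = qbinom k (suc l)
  Y = qbinom (suc k) l
  Q = qpow (suc k)
  K = qint (suc k)
  L = qint (suc l)

-- multichoose a k = [a + k - 1 choose k]_q, which for a = 0 is 1 if k = 0 and 0 otherwise.
multichoose : ℕ → ℕ → Poly
multichoose zero    zero    = 𝟙
multichoose zero    (suc k) = 𝟘
multichoose (suc a) k       = qbinom k a

multichoose-zeroʳ : ∀ a → multichoose a 0 ≡ 𝟙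
multichoose-zeroʳ zero    = refl
multichoose-zeroʳ (suc a) = refl

multichoose-qfact : ∀ a k → multichoose (suc a) k ⊛ (qfact k ⊛ qfact a) ≋ qfact (a + k)
multichoose-qfact a k = ≋-trans (qbinom-qfact k a) (≡⇒≋ (cong qfact (ℕ.+-comm k a)))

multichoose-pascal : ∀ a k →
  qpow (suc k) ⊛ multichoose a (suc k) ⊕ multichoose (suc a) k ≋ multichoose (suc a) (suc k)
multichoose-pascal zero    k = begin
  qpow (suc k) ⊛ 𝟘 ⊕ qbinom k 0  ≈⟨ ⊕-cong (⊛-zeroʳ (qpow (suc k))) ≋-refl ⟩
  qbinom k 0                     ≡⟨ qbinom-zeroʳ k ⟩
  𝟙                              ∎
  where open ≋-Reasoning
multichoose-pascal (suc a) k = ⊕-comm _ (qbinom k (suc a))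

multichoose-suc : ∀ a k →
  ∑[ t ≤ k ] (qpow (k ∸ toℕ t) ⊛ multichoose a (k ∸ toℕ t)) ≋ multichoose (suc a) k
multichoose-suc a zero    = begin
  qpow 0 ⊛ multichoose a 0 ⊕ 𝟘  ≈⟨ ⊕-identityʳ _ ⟩
  𝟙 ⊛ multichoose a 0           ≈⟨ ⊛-identityˡ _ ⟩
  multichoose a 0               ≡⟨ multichoose-zeroʳ a ⟩
  𝟙                             ∎
  where open ≋-Reasoning
multichoose-suc a (suc k) =
  ≋-trans (⊕-cong ≋-refl (multichoose-suc a k)) (multichoose-pascal a k)

sumFin≡sum : ∀ {n} (f : Fin n → Poly) → sumFin f ≡ sum f
sumFin≡sum {zero}  f = refl
sumFin≡sum {suc n} f = cong (f Fin.zero ⊕_) (sumFin≡sum (f ∘ Fin.suc))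

∸-split : ∀ {x y z} → x ≤ y → y ≤ z → z ∸ x ≡ (z ∸ y) + (y ∸ x)
∸-split {x} {y} {z} x≤y y≤z = begin
  z ∸ x              ≡⟨ cong (_∸ x) (ℕ.m∸n+n≡m y≤z) ⟨
  (z ∸ y) + y ∸ x    ≡⟨ ℕ.+-∸-assoc (z ∸ y) x≤y ⟩
  (z ∸ y) + (y ∸ x)  ∎
  where open ≡-Reasoning

upper : ℕ → ℕ → Poly → Poly
upper x y p = if x ≤ᵇ y then p else 𝟘

upper-≤ : ∀ {x y} p → x ≤ y → upper x y p ≡ p
upper-≤ {x} {y} p x≤y with x ≤ᵇ y | ℕ.≤⇒≤ᵇ x≤y
... | true | _ = refl

upper-≰ : ∀ {x y} p → ¬ x ≤ y → upper x y p ≡ 𝟘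
upper-≰ {x} {y} p x≰y with x ≤ᵇ y | ℕ.≤ᵇ⇒≤ x y
... | true  | x≤y = ⊥-elim (x≰y (x≤y tt))
... | false | _   = refl

upper-suc : ∀ x y p → upper (suc x) (suc y) p ≡ upper x y p
upper-suc zero    y p = refl
upper-suc (suc x) y p = refl

upper-⊛-upper : ∀ {x y z} p r → ¬ x ≤ z → upper x y p ⊛ upper y z r ≋ 𝟘
upper-⊛-upper {x} {y} {z} p r x≰z with x ≤? y
... | yes x≤y = ≋-trans (≡⇒≋ (cong (upper x y p ⊛_) (upper-≰ r (x≰z ∘ ℕ.≤-trans x≤y)))) (⊛-zeroʳ (upper x y p))
... | no  x≰y = ≡⇒≋ (cong (_⊛ upper y z r) (upper-≰ p x≰y))

module _ (m : ℕ) where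

  powEntry : ℕ → ℕ → ℕ → Poly
  powEntry a x y = upper x y (qpow (a * (m ∸ y)) ⊛ multichoose a (y ∸ x))

  -- Rm m i j is definitionally RmEntry (toℕ i) (toℕ j).
  RmEntry : ℕ → ℕ → Poly
  RmEntry x y = upper x y (qpow (m ∸ y))

  idMat≋powEntry : ∀ x y → (if x ≡ᵇ y then 𝟙 else 𝟘) ≋ powEntry 0 x y
  idMat≋powEntry zero    zero    = ≋-refl
  idMat≋powEntry zero    (suc y) = ≋-sym (⊛-zeroʳ 𝟙)
  idMat≋powEntry (suc x) zero    = ≋-refl
  idMat≋powEntry (suc x) (suc y) = ≋-trans (idMat≋powEntry x y) (≡⇒≋ (sym (upper-suc x y _)))

  RmEntry⊛powEntry : ∀ a t {x y} → y ≤ m → x + t ≤ y →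
    RmEntry x (x + t) ⊛ powEntry a (x + t) y
      ≋ qpow (suc a * (m ∸ y)) ⊛ (qpow (y ∸ x ∸ t) ⊛ multichoose a (y ∸ x ∸ t))
  RmEntry⊛powEntry a t {x} {y} y≤m x+t≤y = begin
    RmEntry x (x + t) ⊛ powEntry a (x + t) y
      ≡⟨ cong₂ _⊛_ (upper-≤ _ (ℕ.m≤m+n x t)) (upper-≤ _ x+t≤y) ⟩
    qpow (m ∸ (x + t)) ⊛ (qpow (a * (m ∸ y)) ⊛ multichoose a (y ∸ (x + t)))
      ≡⟨ cong₂ (λ e f → qpow e ⊛ (qpow (a * (m ∸ y)) ⊛ multichoose a f)) m∸[x+t] (sym (ℕ.∸-+-assoc y x t)) ⟩
    qpow ((m ∸ y) + k) ⊛ (qpow (a * (m ∸ y)) ⊛ multichoose a k)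
      ≈⟨ ⊛-cong (qpow-+ (m ∸ y) k) ≋-refl ⟩
    (qpow (m ∸ y) ⊛ qpow k) ⊛ (qpow (a * (m ∸ y)) ⊛ multichoose a k)
      ≈⟨ ⊛.interchange (qpow (m ∸ y)) (qpow k) _ _ ⟩
    (qpow (m ∸ y) ⊛ qpow (a * (m ∸ y))) ⊛ (qpow k ⊛ multichoose a k)
      ≈⟨ ⊛-cong (qpow-+ (m ∸ y) (a * (m ∸ y))) ≋-refl ⟨
    qpow (suc a * (m ∸ y)) ⊛ (qpow k ⊛ multichoose a k)
      ∎
    where
    open ≋-Reasoning
    k = y ∸ x ∸ t
    m∸[x+t] : m ∸ (x + t) ≡ (m ∸ y) + k
    m∸[x+t] = trans (∸-split x+t≤y y≤m) (cong ((m ∸ y) +_) (sym (ℕ.∸-+-assoc y x t)))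

  RmEntry⊛powEntry-sum : ∀ a x y → y ≤ m →
    ∑[ l ≤ m ] (RmEntry x (toℕ l) ⊛ powEntry a (toℕ l) y) ≋ powEntry (suc a) x y
  RmEntry⊛powEntry-sum a x y y≤m with x ≤? y
  ... | no x≰y = ≋-trans
    (sum-zeros +-monoid {suc m} (λ l → RmEntry x (toℕ l) ⊛ powEntry a (toℕ l) y)
      (λ l → upper-⊛-upper (qpow (m ∸ toℕ l)) _ x≰y))
    (≡⇒≋ (sym (upper-≰ _ x≰y)))
  ... | yes x≤y = begin
    ∑[ l ≤ m ] term (toℕ l)              ≈⟨ sum-window +-monoid x y term x≤y (s≤s y≤m) below above ⟩
    ∑[ t ≤ k ] term (x + toℕ t)          ≈⟨ sum-cong-≋ (λ t → RmEntry⊛powEntry a (toℕ t) y≤m (x+t≤y t)) ⟩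
    ∑[ t ≤ k ] (Q ⊛ f (toℕ t))           ≈⟨ *-distribˡ-sum {suc k} Q (f ∘ toℕ) ⟨
    Q ⊛ ∑[ t ≤ k ] f (toℕ t)             ≈⟨ ⊛-congʳ Q (multichoose-suc a k) ⟩
    Q ⊛ multichoose (suc a) k            ≡⟨ upper-≤ _ x≤y ⟨
    powEntry (suc a) x y                 ∎
    where
    open ≋-Reasoning
    k = y ∸ x
    Q = qpow (suc a * (m ∸ y))
    f : ℕ → Poly
    f t = qpow (k ∸ t) ⊛ multichoose a (k ∸ t)
    term : ℕ → Poly
    term l = RmEntry x l ⊛ powEntry a l y
    below : ∀ l → l < x → term l ≋ 𝟘
    below l l<x = ≡⇒≋ (cong (_⊛ powEntry a l y) (upper-≰ _ (ℕ.<⇒≱ l<x)))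
    above : ∀ l → y < l → term l ≋ 𝟘
    above l y<l = ≋-trans (⊛-congʳ (RmEntry x l) (≡⇒≋ (upper-≰ _ (ℕ.<⇒≱ y<l)))) (⊛-zeroʳ (RmEntry x l))
    x+t≤y : ∀ (t : Fin (suc k)) → x + toℕ t ≤ y
    x+t≤y t = ℕ.≤-trans (ℕ.+-monoʳ-≤ x (toℕ≤pred[n] t)) (ℕ.≤-reflexive (ℕ.m+[n∸m]≡n x≤y))

  matPow-Rm : ∀ a (i j : Fin (suc m)) → matPow (Rm m) a i j ≋ powEntry a (toℕ i) (toℕ j)
  matPow-Rm zero    i j = idMat≋powEntry (toℕ i) (toℕ j)
  matPow-Rm (suc a) i j = begin
    sumFin (λ l → Rm m i l ⊛ matPow (Rm m) a l j)
      ≡⟨ sumFin≡sum (λ l → Rm m i l ⊛ matPow (Rm m) a l j) ⟩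
    sum (λ l → Rm m i l ⊛ matPow (Rm m) a l j)
      ≈⟨ sum-cong-≋ (λ l → ⊛-congʳ (Rm m i l) (matPow-Rm a l j)) ⟩
    ∑[ l ≤ m ] (RmEntry (toℕ i) (toℕ l) ⊛ powEntry a (toℕ l) (toℕ j))
      ≈⟨ RmEntry⊛powEntry-sum a (toℕ i) (toℕ j) (toℕ≤pred[n] j) ⟩
    powEntry (suc a) (toℕ i) (toℕ j)
      ∎
    where open ≋-Reasoning

mainTheorem1 : (m a : ℕ) → 1 ≤ m → 1 ≤ a → (i j : Fin (suc m)) → toℕ i ≤ toℕ j →
    matPow (Rm m) a i j ⊛ (qfact (toℕ j ∸ toℕ i) ⊛ qfact (a ∸ 1))
      ≈ qpow (a * (m ∸ toℕ j)) ⊛ qfact (a + (toℕ j ∸ toℕ i) ∸ 1)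
mainTheorem1 m (suc b) _ _ i j i≤j = coeff-≡ (begin
  matPow (Rm m) (suc b) i j ⊛ (qfact k ⊛ qfact b)   ≈⟨ ⊛-cong (matPow-Rm m (suc b) i j) ≋-refl ⟩
  powEntry m (suc b) x y ⊛ (qfact k ⊛ qfact b)      ≡⟨ cong (_⊛ (qfact k ⊛ qfact b)) (upper-≤ _ i≤j) ⟩
  (Q ⊛ multichoose (suc b) k) ⊛ (qfact k ⊛ qfact b) ≈⟨ ⊛-assoc Q _ _ ⟩
  Q ⊛ (multichoose (suc b) k ⊛ (qfact k ⊛ qfact b)) ≈⟨ ⊛-congʳ Q (multichoose-qfact b k) ⟩
  Q ⊛ qfact (b + k)                                 ∎)
  where
  open ≋-Reasoning
  x = toℕ i
  y = toℕ j
  k = y ∸ x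
  Q = qpow (suc b * (m ∸ y))
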